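{- Let $G$ be a finite connected graph of order $n$ with vertices $v_1,\dots,v_n$, and let $H$ be a finite connected graph of order at least two, rooted at a vertex $r$, such that $r$ belongs to a minimum connected dom-forcing set of $H$. Let $G(H)$ be the rooted product of $G$ by $H$. Then $F_{cd}(G(H)) = n\,F_{cd}(H)$.
   Context: The rooted product $G(H)$ is obtained by taking $G$ and $n$ disjoint copies $H_1,\dots,H_n$ of the rooted graph $H$ and identifying the root of $H_i$ with $v_i$, for each $i$. Color-change rule: if each vertex is colored black or white, and a black vertex $u$ has exactly one white neighbor $v$, then $v$ is recolored black. A zero forcing set is a vertex set $Z$ such that, starting with exactly the vertices of $Z$ black, repeated application of the color-change rule colors every vertex black. A connected dom-forcing set is a vertex set $S$ that is dominating (every vertex is in $S$ or adjacent to a vertex of $S$), induces a connected subgraph, and is a zero forcing set; $F_{cd}(\cdot)$ is the minimum size of such a set, and a minimum connected dom-forcing set is one of that size. -}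

module Defs where

open import Data.Nat using (ℕ; _*_; _≤_)
open import Data.Bool using (Bool; true; false; T; _∨_; _∧_)
open import Data.Unit using (⊤)
open import Data.Fin using (Fin; remQuot; _≟_)
open import Data.Fin.Subset using (Subset; _∈_; ∣_∣)
open import Data.Product using (Σ; _×_; _,_; ∃)
open import Data.Sum using (_⊎_)
open import Relation.Nullary using (¬_; does)
open import Relation.Binary.PropositionalEquality using (_≡_; _≢_)

Graph : ℕ → Set
Graph n = Fin n → Fin n → Bool

IsSimple : ∀ {n} → Graph n → Set
IsSimple {n} G = (∀ u v → G u v ≡ G v u) × (∀ v → G v v ≡ false)

Adj : ∀ {n} → Graph n → Fin n → Fin n → Set
Adj G u v = T (G u v)

data WalkIn {n} (G : Graph n) (S : Fin n → Set) : Fin n → Fin n → Set where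
  here : ∀ {u} → S u → WalkIn G S u u
  step : ∀ {u v w} → S u → Adj G u v → WalkIn G S v w → WalkIn G S u w

Connected : ∀ {n} → Graph n → Set
Connected G = ∀ u v → WalkIn G (λ _ → ⊤) u v

InducesConnected : ∀ {n} → Graph n → Subset n → Set
InducesConnected G S = ∀ u v → u ∈ S → v ∈ S → WalkIn G (_∈ S) u v

Dominating : ∀ {n} → Graph n → Subset n → Set
Dominating G S = ∀ v → v ∈ S ⊎ (∃ λ u → u ∈ S × Adj G u v)

data Black {n} (G : Graph n) (Z : Subset n) : Fin n → Set where
  initial : ∀ {v} → v ∈ Z → Black G Z v
  force   : ∀ {u v} → Black G Z u → Adj G u v
          → (∀ w → Adj G u w → w ≢ v → Black G Z w) → Black G Z v

ZeroForcing : ∀ {n} → Graph n → Subset n → Set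
ZeroForcing G Z = ∀ v → Black G Z v

ConnDomForcing : ∀ {n} → Graph n → Subset n → Set
ConnDomForcing G S = Dominating G S × InducesConnected G S × ZeroForcing G S

MinConnDomForcing : ∀ {n} → Graph n → Subset n → Set
MinConnDomForcing G S =
  ConnDomForcing G S × (∀ T → ConnDomForcing G T → ∣ S ∣ ≤ ∣ T ∣)

IsFcd : ∀ {n} → Graph n → ℕ → Set
IsFcd G k = ∃ λ S → MinConnDomForcing G S × ∣ S ∣ ≡ k

-- Vertex (i , h) ∈ Fin n × Fin m (encoded in Fin (n * m) via remQuot) is
-- vertex h of the i-th copy H_i; the vertex (i , r) is identified with v_i.
rootedProduct : ∀ {n m} → Graph n → Graph m → Fin m → Graph (n * m)
rootedProduct {n} {m} G H r x y with remQuot {n} m x | remQuot {n} m y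
... | i , h | j , h' =
  (does (i ≟ j) ∧ H h h') ∨ (does (h ≟ r) ∧ does (h' ≟ r) ∧ G i j)

-- Putting a minimum connected dom-forcing set S ∋ r of H into every copy gives
-- a connected dom-forcing set of G(H) of size n ∣S∣: the copies are linked
-- through their roots, and every G-neighbour of a root is a root, hence black.
-- Conversely, let T be any connected dom-forcing set of G(H). Collapsing every
-- copy other than H_i onto r maps forces, walks and dominating edges of G(H)
-- to those of H, provided r lies in the trace T_i of T on H_i. It does: T meets
-- every copy (as m ≥ 2, a non-root vertex of each copy is dominated inside its
-- copy), and a walk in T leaving H_i does so through its root. So each T_i is
-- a connected dom-forcing set of H, and ∣T∣ = Σ ∣T_i∣ ≥ n F_cd(H).
module Submission where

open import Defs
open import Data.Nat using (zero; suc; _+_; _*_; _≤_; z≤n; s≤s)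
open import Data.Nat.Properties using (+-mono-≤; ≤-antisym; module ≤-Reasoning)
open import Data.Bool using (Bool; true; false; T; _∧_; _∨_)
open import Data.Bool.Properties using (T-∧; T-∨)
open import Data.Empty using (⊥-elim)
open import Data.Fin using (Fin; zero; suc; combine; remQuot; punchIn; _≟_)
open import Data.Fin.Properties using (remQuot-combine; combine-remQuot; punchInᵢ≢i)
open import Data.Fin.Subset using (Subset; _∈_; ∣_∣)
open import Data.Vec using ([]; _∷_; _++_; lookup; tabulate; splitAt)
open import Data.Vec.Properties
  using ([]=⇒lookup; lookup⇒[]=; lookup∘tabulate; tabulate∘lookup; tabulate-cong; lookup-++ˡ; lookup-++ʳ)
open import Data.Product using (∃; ∃₂; _×_; _,_; proj₁; proj₂)
open import Data.Product.Function.NonDependent.Propositional using (_×-⇔_)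
open import Data.Sum using (_⊎_; inj₁; inj₂)
open import Data.Sum.Function.Propositional using (_⊎-⇔_)
open import Function using (_∘_; _⇔_; mk⇔; Equivalence)
open import Function.Construct.Composition using (_⇔-∘_)
open import Function.Construct.Identity using (⇔-id)
open import Relation.Nullary using (¬_; yes; no; does)
open import Relation.Unary using (Pred; Decidable)
open import Relation.Binary.PropositionalEquality
  using (_≡_; _≢_; refl; sym; trans; cong; cong₂; subst; subst₂; module ≡-Reasoning)

walkIn-map : ∀ {a b} {G₁ : Graph a} {G₂ : Graph b} {S₁ : Fin a → Set} {S₂ : Fin b → Set}
  (f : Fin a → Fin b) → (∀ {x} → S₁ x → S₂ (f x))
  → (∀ {x y} → Adj G₁ x y → f x ≡ f y ⊎ Adj G₂ (f x) (f y))
  → ∀ {x y} → WalkIn G₁ S₁ x y → WalkIn G₂ S₂ (f x) (f y)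
walkIn-map f f-S f-adj (here s) = here (f-S s)
walkIn-map {G₂ = G₂} {S₂ = S₂} f f-S f-adj (step {w = z} s a w) with f-adj a
... | inj₁ fu≡fv = subst (λ x → WalkIn G₂ S₂ x (f z)) (sym fu≡fv) (walkIn-map f f-S f-adj w)
... | inj₂ a′ = step (f-S s) a′ (walkIn-map f f-S f-adj w)

walkIn-++ : ∀ {a} {G : Graph a} {S : Fin a → Set} {x y z}
  → WalkIn G S x y → WalkIn G S y z → WalkIn G S x z
walkIn-++ (here _) w = w
walkIn-++ (step s a w) w′ = step s a (walkIn-++ w w′)

walkIn-exit : ∀ {a p} {G : Graph a} {S : Fin a → Set} (P : Pred (Fin a) p) → Decidable P
  → ∀ {x y} → WalkIn G S x y → P x → ¬ P y
  → ∃₂ λ u v → S u × P u × ¬ P v × Adj G u v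
walkIn-exit P P? (here _) px ¬py = ⊥-elim (¬py px)
walkIn-exit P P? (step {v = v} s a w) px ¬py with P? v
... | yes pv = walkIn-exit P P? w pv ¬py
... | no ¬pv = _ , _ , s , px , ¬pv , a

∈-tabulate⁺ : ∀ {k} {f : Fin k → Bool} {x} → f x ≡ true → x ∈ tabulate f
∈-tabulate⁺ {f = f} {x} fx = lookup⇒[]= x _ (trans (lookup∘tabulate f x) fx)

∈-tabulate⁻ : ∀ {k} {f : Fin k → Bool} {x} → x ∈ tabulate f → f x ≡ true
∈-tabulate⁻ {f = f} {x} x∈ = trans (sym (lookup∘tabulate f x)) ([]=⇒lookup x∈)

slice : ∀ {n m} → Subset (n * m) → Fin n → Subset m
slice T i = tabulate (λ h → lookup T (combine i h))

∈slice⁺ : ∀ {n m} {T : Subset (n * m)} (i : Fin n) {h : Fin m} → combine i h ∈ T → h ∈ slice T i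
∈slice⁺ {T = T} i x∈ = ∈-tabulate⁺ {f = λ h → lookup T (combine i h)} ([]=⇒lookup x∈)

∈slice⁻ : ∀ {n m} {T : Subset (n * m)} (i : Fin n) {h : Fin m} → h ∈ slice T i → combine i h ∈ T
∈slice⁻ {T = T} i {h} h∈ = lookup⇒[]= (combine i h) T (∈-tabulate⁻ {f = λ h → lookup T (combine i h)} h∈)

∣++∣ : ∀ {a b} (xs : Subset a) (ys : Subset b) → ∣ xs ++ ys ∣ ≡ ∣ xs ∣ + ∣ ys ∣
∣++∣ [] ys = refl
∣++∣ (true ∷ xs) ys = cong suc (∣++∣ xs ys)
∣++∣ (false ∷ xs) ys = ∣++∣ xs ys

slice-++-zero : ∀ {n m} (xs : Subset m) (ys : Subset (n * m)) → slice {suc n} (xs ++ ys) zero ≡ xs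
slice-++-zero xs ys = trans (tabulate-cong (lookup-++ˡ xs ys)) (tabulate∘lookup xs)

slice-++-suc : ∀ {n m} (xs : Subset m) (ys : Subset (n * m)) i → slice {suc n} (xs ++ ys) (suc i) ≡ slice ys i
slice-++-suc xs ys i = tabulate-cong (λ h → lookup-++ʳ xs ys (combine i h))

∣∣-slices-≥ : ∀ n {m k} (T : Subset (n * m)) → (∀ (i : Fin n) → k ≤ ∣ slice T i ∣) → n * k ≤ ∣ T ∣
∣∣-slices-≥ zero T _ = z≤n
∣∣-slices-≥ (suc n) {m} {k} T k≤ with splitAt m T
... | xs , ys , refl = begin
  k + n * k         ≤⟨ +-mono-≤ k≤∣xs∣ (∣∣-slices-≥ n ys k≤∣ys∣) ⟩
  ∣ xs ∣ + ∣ ys ∣   ≡⟨ ∣++∣ xs ys ⟨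
  ∣ xs ++ ys ∣      ∎
  where
  open ≤-Reasoning
  k≤∣xs∣ : k ≤ ∣ xs ∣
  k≤∣xs∣ = subst (k ≤_) (cong ∣_∣ (slice-++-zero {n} xs ys)) (k≤ zero)
  k≤∣ys∣ : ∀ i → k ≤ ∣ slice ys i ∣
  k≤∣ys∣ i = subst (k ≤_) (cong ∣_∣ (slice-++-suc xs ys i)) (k≤ (suc i))

∣∣-slices-≡ : ∀ n {m} (T : Subset (n * m)) (S : Subset m)
  → (∀ (i : Fin n) → slice T i ≡ S) → ∣ T ∣ ≡ n * ∣ S ∣
∣∣-slices-≡ zero [] S _ = refl
∣∣-slices-≡ (suc n) {m} T S slice≡S with splitAt m T
... | xs , ys , refl = begin
  ∣ xs ++ ys ∣      ≡⟨ ∣++∣ xs ys ⟩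
  ∣ xs ∣ + ∣ ys ∣   ≡⟨ cong₂ _+_ (cong ∣_∣ xs≡S) (∣∣-slices-≡ n ys S ys-slice≡S) ⟩
  ∣ S ∣ + n * ∣ S ∣ ∎
  where
  open ≡-Reasoning
  xs≡S : xs ≡ S
  xs≡S = trans (sym (slice-++-zero {n} xs ys)) (slice≡S zero)
  ys-slice≡S : ∀ i → slice ys i ≡ S
  ys-slice≡S i = trans (sym (slice-++-suc xs ys i)) (slice≡S (suc i))

module RootedProduct {n m} (G : Graph n) (H : Graph m) (r : Fin m) where

  GH : Graph (n * m)
  GH = rootedProduct G H r

  copyOf : Fin (n * m) → Fin n
  copyOf x = proj₁ (remQuot {n} m x)

  vertexOf : Fin (n * m) → Fin m
  vertexOf x = proj₂ (remQuot {n} m x)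

  copyOf-combine : ∀ (i : Fin n) (h : Fin m) → copyOf (combine i h) ≡ i
  copyOf-combine i h = cong proj₁ (remQuot-combine i h)

  vertexOf-combine : ∀ (i : Fin n) (h : Fin m) → vertexOf (combine i h) ≡ h
  vertexOf-combine i h = cong proj₂ (remQuot-combine i h)

  combine-vertexOf : ∀ {i} x → copyOf x ≡ i → combine i (vertexOf x) ≡ x
  combine-vertexOf x refl = combine-remQuot {n} m x

  _∼_ : Fin n × Fin m → Fin n × Fin m → Set
  (i , h) ∼ (j , h′) = (i ≡ j × Adj H h h′) ⊎ (h ≡ r × h′ ≡ r × Adj G i j)

  adj⇔∼ : ∀ x y → Adj GH x y ⇔ remQuot {n} m x ∼ remQuot {n} m y
  adj⇔∼ x y = ((≟⇔≡ ×-⇔ ⇔-id _) ⊎-⇔ (≟⇔≡ ×-⇔ ≟⇔≡ ×-⇔ ⇔-id _))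
          ⇔-∘ ((T-∧ ⊎-⇔ ((⇔-id _ ×-⇔ T-∧) ⇔-∘ T-∧)) ⇔-∘ T-∨)
    where
    ≟⇔≡ : ∀ {k} {a b : Fin k} → T (does (a ≟ b)) ⇔ (a ≡ b)
    ≟⇔≡ {a = a} {b} with a ≟ b
    ... | yes a≡b = mk⇔ (λ _ → a≡b) _
    ... | no a≢b = mk⇔ (λ ()) a≢b

  adj-cases : ∀ {x y} → Adj GH x y
    → (copyOf x ≡ copyOf y × Adj H (vertexOf x) (vertexOf y))
    ⊎ (vertexOf x ≡ r × vertexOf y ≡ r × Adj G (copyOf x) (copyOf y))
  adj-cases {x} {y} = Equivalence.to (adj⇔∼ x y)

  adj-combine : ∀ {i j h h′} → (i , h) ∼ (j , h′) → Adj GH (combine i h) (combine j h′)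
  adj-combine {i} {j} {h} {h′} i,h∼j,h′ = Equivalence.from (adj⇔∼ (combine i h) (combine j h′))
    (subst₂ _∼_ (sym (remQuot-combine i h)) (sym (remQuot-combine j h′)) i,h∼j,h′)

  adj-copy : ∀ (i : Fin n) {h h′} → Adj H h h′ → Adj GH (combine i h) (combine i h′)
  adj-copy i a = adj-combine (inj₁ (refl , a))

  adj-root : ∀ {i j} → Adj G i j → Adj GH (combine i r) (combine j r)
  adj-root g = adj-combine (inj₂ (refl , refl , g))

  cross-copy-edge : ∀ {x y} → Adj GH x y → copyOf x ≢ copyOf y → vertexOf x ≡ r × vertexOf y ≡ r
  cross-copy-edge a x≁y with adj-cases a
  ... | inj₁ (x≈y , _) = ⊥-elim (x≁y x≈y)
  ... | inj₂ (x-root , y-root , _) = x-root , y-root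

  module _ (S : Subset m) where

    everyCopy : Subset (n * m)
    everyCopy = tabulate (λ x → lookup S (vertexOf x))

    ∈everyCopy⁺ : ∀ {x} → vertexOf x ∈ S → x ∈ everyCopy
    ∈everyCopy⁺ {x} x∈ = ∈-tabulate⁺ {f = λ x → lookup S (vertexOf x)} ([]=⇒lookup x∈)

    ∈everyCopy⁻ : ∀ {x} → x ∈ everyCopy → vertexOf x ∈ S
    ∈everyCopy⁻ {x} x∈ = lookup⇒[]= (vertexOf x) S (∈-tabulate⁻ {f = λ x → lookup S (vertexOf x)} x∈)

    combine-∈everyCopy : ∀ i {h} → h ∈ S → combine i h ∈ everyCopy
    combine-∈everyCopy i {h} h∈ = ∈everyCopy⁺ (subst (_∈ S) (sym (vertexOf-combine i h)) h∈)

    ∣everyCopy∣ : ∣ everyCopy ∣ ≡ n * ∣ S ∣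
    ∣everyCopy∣ = ∣∣-slices-≡ n everyCopy S slice≡S
      where
      slice≡S : ∀ i → slice everyCopy i ≡ S
      slice≡S i = trans
        (tabulate-cong λ h → trans (lookup∘tabulate _ (combine i h)) (cong (lookup S) (vertexOf-combine i h)))
        (tabulate∘lookup S)

    everyCopy-dominating : Dominating H S → Dominating GH everyCopy
    everyCopy-dominating S-dom x with S-dom (vertexOf x)
    ... | inj₁ x∈S = inj₁ (∈everyCopy⁺ x∈S)
    ... | inj₂ (h , h∈S , h∼x) = inj₂ (combine (copyOf x) h , combine-∈everyCopy _ h∈S ,
      subst (Adj GH _) (combine-vertexOf x refl) (adj-copy _ h∼x))

    module _ (r∈S : r ∈ S) where

      everyCopy-connected : Connected G → InducesConnected H S → InducesConnected GH everyCopy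
      everyCopy-connected G-conn S-conn x y x∈ y∈ = subst₂ (WalkIn GH (_∈ everyCopy))
        (combine-vertexOf x refl) (combine-vertexOf y refl)
        (walkIn-++ (inCopy (S-conn _ r (∈everyCopy⁻ x∈) r∈S))
          (walkIn-++ (walkIn-map (λ j → combine j r) (λ _ → combine-∈everyCopy _ r∈S) (inj₂ ∘ adj-root)
                       (G-conn (copyOf x) (copyOf y)))
            (inCopy (S-conn r _ r∈S (∈everyCopy⁻ y∈)))))
        where
        inCopy : ∀ {i h h′} → WalkIn H (_∈ S) h h′ → WalkIn GH (_∈ everyCopy) (combine i h) (combine i h′)
        inCopy {i} = walkIn-map (combine i) (combine-∈everyCopy i) (inj₂ ∘ adj-copy i)

      -- A root (i, r) may force within H_i: its other neighbours are roots, black from the start.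
      everyCopy-black : ∀ i {h} → Black H S h → Black GH everyCopy (combine i h)
      everyCopy-black i (initial h∈S) = initial (combine-∈everyCopy i h∈S)
      everyCopy-black i {v} (force {u} u-black u∼v others) =
        force (everyCopy-black i u-black) (adj-copy i u∼v) others′
        where
        others′ : ∀ y → Adj GH (combine i u) y → y ≢ combine i v → Black GH everyCopy y
        others′ y u∼y y≢v with adj-cases u∼y
        ... | inj₂ (_ , y-root , _) = initial (∈everyCopy⁺ (subst (_∈ S) (sym y-root) r∈S))
        ... | inj₁ (same-copy , u∼y′) = subst (Black GH everyCopy) y≡i,y′
                (everyCopy-black i (others (vertexOf y)
                  (subst (λ z → Adj H z (vertexOf y)) (vertexOf-combine i u) u∼y′)
                  (λ e → y≢v (trans (sym y≡i,y′) (cong (combine i) e)))))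
          where
          y≡i,y′ : combine i (vertexOf y) ≡ y
          y≡i,y′ = combine-vertexOf y (trans (sym same-copy) (copyOf-combine i u))

      everyCopy-connDomForcing : Connected G → ConnDomForcing H S → ConnDomForcing GH everyCopy
      everyCopy-connDomForcing G-conn (S-dom , S-conn , S-zf) =
          everyCopy-dominating S-dom
        , everyCopy-connected G-conn S-conn
        , λ x → subst (Black GH everyCopy) (combine-vertexOf x refl) (everyCopy-black (copyOf x) (S-zf (vertexOf x)))

  copy-meets : 2 ≤ m → ∀ {T} → Dominating GH T → ∀ (i : Fin n) → ∃ λ h → combine i h ∈ T
  copy-meets (s≤s (s≤s _)) {T} T-dom i with T-dom (combine i (punchIn r zero))
  ... | inj₁ i,h₀∈T = _ , i,h₀∈T
  ... | inj₂ (u , u∈T , u∼i,h₀) with copyOf u ≟ i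
  ...   | yes u∈i = vertexOf u , subst (_∈ T) (sym (combine-vertexOf u u∈i)) u∈T
  ...   | no u∉i = ⊥-elim (punchInᵢ≢i r zero (trans (sym (vertexOf-combine i _))
            (proj₂ (cross-copy-edge u∼i,h₀ (λ e → u∉i (trans e (copyOf-combine i _)))))))

  root∈slice : 2 ≤ m → ∀ {T} → Dominating GH T → InducesConnected GH T
    → ∀ {i j : Fin n} → j ≢ i → r ∈ slice T i
  root∈slice m≥2 {T} T-dom T-conn {i} {j} j≢i with copy-meets m≥2 T-dom i | copy-meets m≥2 T-dom j
  ... | h , i,h∈T | h′ , j,h′∈T
    with walkIn-exit (λ x → copyOf x ≡ i) (λ x → copyOf x ≟ i) (T-conn _ _ i,h∈T j,h′∈T)
           (copyOf-combine i h) (λ e → j≢i (trans (sym (copyOf-combine j h′)) e))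
  ... | u , v , u∈T , u∈i , v∉i , u∼v = ∈slice⁺ i (subst (_∈ T) (sym i,r≡u) u∈T)
    where
    i,r≡u : combine i r ≡ u
    i,r≡u = trans (cong (combine i) (sym (proj₁ (cross-copy-edge u∼v (λ e → v∉i (trans (sym e) u∈i))))))
                  (combine-vertexOf u u∈i)

  module Projection (T : Subset (n * m)) (i : Fin n) (r∈Tᵢ : ∀ {j : Fin n} → j ≢ i → r ∈ slice T i) where

    Tᵢ : Subset m
    Tᵢ = slice T i

    project : Fin (n * m) → Fin m
    project x with copyOf x ≟ i
    ... | yes _ = vertexOf x
    ... | no _ = r

    project-inside : ∀ {x} → copyOf x ≡ i → project x ≡ vertexOf x
    project-inside {x} x∈i with copyOf x ≟ i
    ... | yes _ = refl
    ... | no x∉i = ⊥-elim (x∉i x∈i)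

    project-root : ∀ {x} → vertexOf x ≡ r → project x ≡ r
    project-root {x} x-root with copyOf x ≟ i
    ... | yes _ = x-root
    ... | no _ = refl

    project-combine : ∀ h → project (combine i h) ≡ h
    project-combine h = trans (project-inside (copyOf-combine i h)) (vertexOf-combine i h)

    project-∈ : ∀ {x} → x ∈ T → project x ∈ Tᵢ
    project-∈ {x} x∈T with copyOf x ≟ i
    ... | yes x∈i = ∈slice⁺ i (subst (_∈ T) (sym (combine-vertexOf x x∈i)) x∈T)
    ... | no x∉i = r∈Tᵢ x∉i

    project-adj : ∀ {x y} → Adj GH x y → project x ≡ project y ⊎ Adj H (project x) (project y)
    project-adj {x} {y} x∼y with adj-cases x∼y
    ... | inj₂ (x-root , y-root , _) = inj₁ (trans (project-root x-root) (sym (project-root y-root)))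
    ... | inj₁ (same-copy , x∼y′) with copyOf x ≟ i | copyOf y ≟ i
    ...   | yes _ | yes _ = inj₂ x∼y′
    ...   | no _ | no _ = inj₁ refl
    ...   | yes x∈i | no y∉i = ⊥-elim (y∉i (trans (sym same-copy) x∈i))
    ...   | no x∉i | yes y∈i = ⊥-elim (x∉i (trans same-copy y∈i))

    slice-dominating : Dominating GH T → Dominating H Tᵢ
    slice-dominating T-dom h with T-dom (combine i h)
    ... | inj₁ i,h∈T = inj₁ (∈slice⁺ i i,h∈T)
    ... | inj₂ (u , u∈T , u∼i,h) with project-adj u∼i,h
    ...   | inj₁ u↦h = inj₁ (subst (_∈ Tᵢ) (trans u↦h (project-combine h)) (project-∈ u∈T))
    ...   | inj₂ u∼h = inj₂ (project u , project-∈ u∈T , subst (Adj H _) (project-combine h) u∼h)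

    slice-connected : InducesConnected GH T → InducesConnected H Tᵢ
    slice-connected T-conn h h′ h∈ h′∈ = subst₂ (WalkIn H (_∈ Tᵢ)) (project-combine h) (project-combine h′)
      (walkIn-map project project-∈ project-adj (T-conn _ _ (∈slice⁻ i h∈) (∈slice⁻ i h′∈)))

    slice-black : ∀ {x} → Black GH T x → Black H Tᵢ (project x)
    slice-black (initial x∈T) = initial (project-∈ x∈T)
    slice-black (force {u} {v} u-black u∼v others) with copyOf u ≟ i | copyOf v ≟ i
    ... | _ | no v∉i = initial (r∈Tᵢ v∉i)
    ... | no u∉i | yes v∈i = initial (subst (_∈ Tᵢ) (sym v-root) (r∈Tᵢ u∉i))
      where
      v-root : vertexOf v ≡ r
      v-root = proj₂ (cross-copy-edge u∼v (λ e → u∉i (trans e v∈i)))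
    ... | yes u∈i | yes v∈i with adj-cases u∼v
    ...   | inj₂ (u-root , v-root , _) =
            subst (Black H Tᵢ) (trans (project-root u-root) (sym v-root)) (slice-black u-black)
    ...   | inj₁ (_ , u∼v′) =
            force (subst (Black H Tᵢ) (project-inside u∈i) (slice-black u-black)) u∼v′ others′
      where
      others′ : ∀ w → Adj H (vertexOf u) w → w ≢ vertexOf v → Black H Tᵢ w
      others′ w u∼w w≢v = subst (Black H Tᵢ) (project-combine w) (slice-black (others (combine i w)
        (subst (λ z → Adj GH z (combine i w)) (combine-vertexOf u u∈i) (adj-copy i u∼w))
        (λ e → w≢v (trans (sym (vertexOf-combine i w)) (cong vertexOf e)))))

  slice-connDomForcing : 2 ≤ m → ∀ {T} → ConnDomForcing GH T → ∀ (i : Fin n) → ConnDomForcing H (slice T i)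
  slice-connDomForcing m≥2 {T} (T-dom , T-conn , T-zf) i =
      slice-dominating T-dom
    , slice-connected T-conn
    , λ h → subst (Black H Tᵢ) (project-combine h) (slice-black (T-zf (combine i h)))
    where open Projection T i (root∈slice m≥2 T-dom T-conn)

mainTheorem14 : ∀ {n m} (G : Graph n) (H : Graph m) (r : Fin m)
    → IsSimple G → Connected G
    → IsSimple H → Connected H → 2 ≤ m
    → (∃ λ S → MinConnDomForcing H S × r ∈ S)
    → ∀ k → IsFcd H k → IsFcd (rootedProduct G H r) (n * k)
mainTheorem14 {n} G H r _ G-conn _ _ m≥2 (S , (S-cdf , S-min) , r∈S) k (S′ , (S′-cdf , S′-min) , ∣S′∣≡k) =
  everyCopy S , (everyCopy-connDomForcing S r∈S G-conn S-cdf , minimal) , ∣everyCopy∣≡nk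
  where
  open RootedProduct G H r
  ∣S∣≡k : ∣ S ∣ ≡ k
  ∣S∣≡k = trans (≤-antisym (S-min S′ S′-cdf) (S′-min S S-cdf)) ∣S′∣≡k
  ∣everyCopy∣≡nk : ∣ everyCopy S ∣ ≡ n * k
  ∣everyCopy∣≡nk = trans (∣everyCopy∣ S) (cong (n *_) ∣S∣≡k)
  minimal : ∀ T → ConnDomForcing GH T → ∣ everyCopy S ∣ ≤ ∣ T ∣
  minimal T T-cdf = subst (_≤ ∣ T ∣) (sym (∣everyCopy∣ S))
    (∣∣-slices-≥ n T (λ i → S-min (slice T i) (slice-connDomForcing m≥2 T-cdf i)))
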